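{- Let $n \ge 3$. Define maps from faces of $\Delta_n$ to faces of $\Delta_{n+1}$ by: for a face $F$ of $\Delta_n$, $A(F)=F$ and $B(F)=F\cup\{\{2,\ldots,n\}\}$; for a face $F$ and $S\in F$, $C(F,S) = \{T\cup\{n+1\} : T\in F, S\subseteq T\}\cup\{T : T \in F, S\not\subseteq T\}$ and $D(F,S) = C(F,S)\cup\{S\}$. Let $Q$ be the subposet of the face poset (including the empty face) of $\Delta_{n+1}$ consisting of all faces $A(F)$, $B(F)$, $C(F,S)$, $D(F,S)$ with $F$ ranging over faces of $\Delta_n$ and $S\in F$. Let $M$ be the matching on $Q$ consisting of the pairs $\{A(F),B(F)\}$ and $\{C(F,S),D(F,S)\}$ (with the edges oriented from $A(F)$ to $B(F)$ and from $C(F,S)$ to $D(F,S)$). Then $M$ is a Morse matching on $Q$.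
   Context: For $m \ge 3$, the Whitehouse complex $\Delta_m$ is the simplicial complex with vertex set $V_m = \{S \subseteq \{2,\ldots,m\} : 2 \le |S| \le m-2\}$, in which $F \subseteq V_m$ is a face iff any two $S,T \in F$ satisfy $S \subseteq T$, $T \subseteq S$, or $S \cap T = \emptyset$. The face poset consists of all faces ordered by inclusion. A matching $M$ on a poset (pairwise disjoint cover pairs) is a Morse matching if the directed graph obtained from the Hasse diagram by orienting each cover edge downward, except the edges of $M$ oriented upward, has no directed cycle. -}

module Defs where

open import Level using (Level) renaming (suc to lsuc; zero to lzero)
open import Data.Nat using (ℕ; zero; suc; _≤_; _∸_)
open import Data.Bool using (Bool; true; false)
open import Data.Vec using (Vec; []; _∷_; _∷ʳ_; replicate)
open import Data.Fin.Subset using (Subset; _⊆_; _∩_; ∣_∣; inside; outside)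
  renaming (⊥ to ∅ˢ)
open import Data.Product using (Σ; _×_; _,_)
open import Data.Sum using (_⊎_)
open import Relation.Nullary using (¬_)
open import Relation.Binary.PropositionalEquality using (_≡_)
open import Relation.Binary.Construct.Closure.Transitive using (TransClosure)

-- Ground set convention: a subset of {1,…,m} is a `Subset m`
-- (a Vec Bool m), where index i : Fin m stands for the number i+1.
-- Vertices of Δ_m are subsets of {2,…,m}, i.e. subsets of {1,…,m}
-- not containing 1.

NoOne : ∀ {m} → Subset m → Set
NoOne []      = Data.Unit.⊤ where import Data.Unit
NoOne (b ∷ _) = b ≡ outside

IsVertex : (m : ℕ) → Subset m → Set
IsVertex m S = NoOne S × (2 ≤ ∣ S ∣) × (∣ S ∣ ≤ m ∸ 2)

Disjoint : ∀ {m} → Subset m → Subset m → Set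
Disjoint S T = S ∩ T ≡ ∅ˢ

Compatible : ∀ {m} → Subset m → Subset m → Set
Compatible S T = S ⊆ T ⊎ T ⊆ S ⊎ Disjoint S T

-- A (candidate) face: a set of subsets of {1,…,m}, given by its
-- membership predicate.  Faces are compared extensionally.
Face : ℕ → Set₁
Face m = Subset m → Set

IsFace : (m : ℕ) → Face m → Set
IsFace m F = (∀ S → F S → IsVertex m S)
           × (∀ S T → F S → F T → Compatible S T)

_⊑_ : ∀ {m} → Face m → Face m → Set
F ⊑ G = ∀ U → F U → G U

_≈_ : ∀ {m} → Face m → Face m → Set
F ≈ G = (F ⊑ G) × (G ⊑ F)

_⊏_ : ∀ {m} → Face m → Face m → Set
F ⊏ G = (F ⊑ G) × ¬ (G ⊑ F)

ext : ∀ {n} → Subset n → Subset (suc n)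
ext S = S ∷ʳ outside

addLast : ∀ {n} → Subset n → Subset (suc n)
addLast S = S ∷ʳ inside

twoToN : (n : ℕ) → Subset n
twoToN zero    = []
twoToN (suc n) = outside ∷ replicate n inside

mapA : ∀ {n} → Face n → Face (suc n)
mapA F U = Σ _ λ T → (U ≡ ext T) × F T

mapB : ∀ {n} → Face n → Face (suc n)
mapB {n} F U = mapA F U ⊎ (U ≡ ext (twoToN n))

mapC : ∀ {n} → Face n → Subset n → Face (suc n)
mapC F S U = (Σ _ λ T → (U ≡ addLast T) × F T × S ⊆ T)
           ⊎ (Σ _ λ T → (U ≡ ext T) × F T × ¬ (S ⊆ T))

mapD : ∀ {n} → Face n → Subset n → Face (suc n)
mapD F S U = mapC F S U ⊎ (U ≡ ext S)

InQ : (n : ℕ) → Face (suc n) → Set₁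
InQ n G = (Σ (Face n) λ F → IsFace n F × (G ≈ mapA F))
        ⊎ (Σ (Face n) λ F → IsFace n F × (G ≈ mapB F))
        ⊎ (Σ (Face n) λ F → IsFace n F × Σ (Subset n) λ S → F S × (G ≈ mapC F S))
        ⊎ (Σ (Face n) λ F → IsFace n F × Σ (Subset n) λ S → F S × (G ≈ mapD F S))

CoverQ : (n : ℕ) → Face (suc n) → Face (suc n) → Set₁
CoverQ n G H = InQ n G × InQ n H × (G ⊏ H)
             × ¬ (Σ (Face (suc n)) λ K → InQ n K × (G ⊏ K) × (K ⊏ H))

InM : (n : ℕ) → Face (suc n) → Face (suc n) → Set₁
InM n G H = (Σ (Face n) λ F → IsFace n F × (G ≈ mapA F) × (H ≈ mapB F))
          ⊎ (Σ (Face n) λ F → IsFace n F × Σ (Subset n) λ S → F S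
               × (G ≈ mapC F S) × (H ≈ mapD F S))

IsMatchingQ : (n : ℕ) → (Face (suc n) → Face (suc n) → Set₁) → Set₁
IsMatchingQ n Mt =
    (∀ G H → Mt G H → CoverQ n G H)
  × (∀ G H G' H' → Mt G H → Mt G' H' →
       (G ≈ G') ⊎ (G ≈ H') ⊎ (H ≈ G') ⊎ (H ≈ H') →
       (G ≈ G') × (H ≈ H'))

MorseEdge : (n : ℕ) → (Face (suc n) → Face (suc n) → Set₁)
          → Face (suc n) → Face (suc n) → Set₁
MorseEdge n Mt X Y = (CoverQ n Y X × ¬ Mt Y X) ⊎ (CoverQ n X Y × Mt X Y)

AcyclicQ : (n : ℕ) → (Face (suc n) → Face (suc n) → Set₁) → Set₁
AcyclicQ n Mt = ∀ G → ¬ TransClosure (MorseEdge n Mt) G G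

IsMorseMatchingQ : (n : ℕ) → (Face (suc n) → Face (suc n) → Set₁) → Set₁
IsMorseMatchingQ n Mt = IsMatchingQ n Mt × AcyclicQ n Mt

{-# OPTIONS --safe #-}

-- Every element X of Q lies on exactly one pair of M, and the pair can be read off from two
-- faces of Δ_n depending monotonically on X: deleting n+1 from the vertices of X recovers F,
-- and the vertices that contain n+1 recover S as their least element (there are none for A
-- and B). So this key never grows along a Morse edge. A matched edge keeps it and enlarges
-- the face; an unmatched downward edge keeping it would join the two members of one pair and
-- so be matched. Hence a directed cycle would strictly increase in a lexicographic order.
-- The pairs are covers because B(F) and D(F,S) each add a single vertex.
module Submission where

open import Defs
open import Level using (Level)
open import Function using (_∘_)
open import Data.Nat using (ℕ; zero; suc; _≤_)
open import Data.Nat.Properties using (1+n≰n)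
open import Data.Unit using (⊤; tt)
open import Data.Empty using (⊥; ⊥-elim)
open import Data.Vec.Properties using (∷ʳ-injectiveˡ; ∷ʳ-injectiveʳ)
open import Data.Fin.Subset using (Subset; _⊆_)
open import Data.Fin.Subset.Properties using (⊆-refl; ⊆-antisym; _⊆?_; ∣⊤∣≡n)
open import Data.Product using (Σ; _×_; _,_; proj₁; proj₂)
open import Data.Sum using (_⊎_; inj₁; inj₂; map₁)
open import Relation.Nullary using (¬_; yes; no)
open import Relation.Binary.Core using (Rel; _⇒_)
open import Relation.Binary.Definitions using (Transitive)
open import Relation.Binary.PropositionalEquality using (_≡_; _≢_; refl; sym; cong; subst)
open import Relation.Binary.Construct.Closure.Transitive using (TransClosure; [_]; _∷_)

private
  variable
    a ℓ r : Level
    m n : ℕ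
    F G H : Face m

transClosure-minimal : {A : Set a} {E : Rel A ℓ} {R : Rel A r} →
                       E ⇒ R → Transitive R → TransClosure E ⇒ R
transClosure-minimal E⇒R R-trans [ e ]    = E⇒R e
transClosure-minimal E⇒R R-trans (e ∷ es) = R-trans (E⇒R e) (transClosure-minimal E⇒R R-trans es)

module Lexicographic {A : Set a} (_≤_ : Rel A ℓ) (≤-trans : Transitive _≤_)
                     (_<_ : Rel A r) (<-trans : Transitive _<_) where

  -- The implication replaces a case split on x ≤ y, which need not be decidable.
  infix 4 _⊲_
  _⊲_ : Rel A _
  x ⊲ y = y ≤ x × (x ≤ y → x < y)

  ⊲-trans : Transitive _⊲_
  ⊲-trans (y≤x , x<y) (z≤y , y<z) =
    ≤-trans z≤y y≤x , λ x≤z → <-trans (x<y (≤-trans x≤z z≤y)) (y<z (≤-trans y≤x x≤z))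

  ⊲-irrefl : (∀ {x} → ¬ x < x) → ∀ {x} → ¬ x ⊲ x
  ⊲-irrefl <-irrefl (x≤x , x<x) = <-irrefl (x<x x≤x)

⊑-trans : F ⊑ G → G ⊑ H → F ⊑ H
⊑-trans F⊑G G⊑H U = G⊑H U ∘ F⊑G U

≈-sym : F ≈ G → G ≈ F
≈-sym (F⊑G , G⊑F) = G⊑F , F⊑G

≈-trans : F ≈ G → G ≈ H → F ≈ H
≈-trans (F⊑G , G⊑F) (G⊑H , H⊑G) = ⊑-trans F⊑G G⊑H , ⊑-trans H⊑G G⊑F

⊏-trans : F ⊏ G → G ⊏ H → F ⊏ H
⊏-trans (F⊑G , G⋢F) (G⊑H , H⋢G) = ⊑-trans F⊑G G⊑H , λ H⊑F → H⋢G (⊑-trans H⊑F F⊑G)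

⊏-irrefl : ¬ F ⊏ F
⊏-irrefl (_ , F⋢F) = F⋢F λ _ x → x

infixl 30 _∪｛_｝
_∪｛_｝ : Face m → Subset m → Face m
(F ∪｛ u ｝) U = F U ⊎ U ≡ u

adjoin-covers : {L G H : Face m} {u : Subset m} → ¬ L u → G ≈ L → H ≈ L ∪｛ u ｝ →
                G ⊏ H × (∀ {K} → G ⊏ K → ¬ K ⊏ H)
adjoin-covers {L = L} {G} {H} {u} u∉L (G⊑L , L⊑G) (H⊑L+u , L+u⊑H) =
  (G⊑H , λ H⊑G → u∉L (G⊑L u (H⊑G u u∈H))) , nothing-between
  where
  G⊑H : G ⊑ H
  G⊑H U = L+u⊑H U ∘ inj₁ ∘ G⊑L U

  u∈H : H u
  u∈H = L+u⊑H u (inj₂ refl)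

  nothing-between : ∀ {K} → G ⊏ K → ¬ K ⊏ H
  nothing-between {K} (G⊑K , K⋢G) (K⊑H , H⋢K) = K⋢G K⊑G
    where
    u∉K : ¬ K u
    u∉K u∈K = H⋢K λ U → L+u⊑K U ∘ H⊑L+u U
      where
      L+u⊑K : L ∪｛ u ｝ ⊑ K
      L+u⊑K U (inj₁ U∈L) = G⊑K U (L⊑G U U∈L)
      L+u⊑K U (inj₂ refl) = u∈K

    K⊑G : K ⊑ G
    K⊑G U U∈K with H⊑L+u U (K⊑H U U∈K)
    ... | inj₁ U∈L  = L⊑G U U∈L
    ... | inj₂ refl = ⊥-elim (u∉K U∈K)

ext≢addLast : {S T : Subset n} → ext S ≢ addLast T
ext≢addLast {S = S} {T} eq with ∷ʳ-injectiveʳ S T eq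
... | ()

twoToN-not-vertex : ∀ n → ¬ IsVertex n (twoToN n)
twoToN-not-vertex zero          (_ , () , _)
twoToN-not-vertex (suc zero)    (_ , () , _)
twoToN-not-vertex (suc (suc n)) (_ , _ , ≤n) = 1+n≰n (subst (_≤ n) (∣⊤∣≡n (suc n)) ≤n)

-- The vertex condition drops {2,…,n}, which B(F) adds but which is not a vertex of Δ_n.
erase : Face (suc n) → Face n
erase X T = IsVertex _ T × (X (ext T) ⊎ X (addLast T))

withLast : Face (suc n) → Face n
withLast X T = X (addLast T)

erase-mono : {X Y : Face (suc n)} → X ⊑ Y → erase X ⊑ erase Y
erase-mono X⊑Y T (vT , inj₁ x) = vT , inj₁ (X⊑Y (ext T) x)
erase-mono X⊑Y T (vT , inj₂ x) = vT , inj₂ (X⊑Y (addLast T) x)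

withLast-mono : {X Y : Face (suc n)} → X ⊑ Y → withLast X ⊑ withLast Y
withLast-mono X⊑Y T = X⊑Y (addLast T)

erase-cong : {X Y : Face (suc n)} → X ≈ Y → erase X ≈ erase Y
erase-cong (X⊑Y , Y⊑X) = erase-mono X⊑Y , erase-mono Y⊑X

withLast-cong : {X Y : Face (suc n)} → X ≈ Y → withLast X ≈ withLast Y
withLast-cong (X⊑Y , Y⊑X) = withLast-mono X⊑Y , withLast-mono Y⊑X

data Kind (n : ℕ) : Set where
  ab : Kind n
  cd : Subset n → Kind n

Valid : Face n → Kind n → Set
Valid F ab     = ⊤
Valid F (cd S) = F S

low : Face n → Kind n → Face (suc n)
low F ab     = mapA F
low F (cd S) = mapC F S

added : Kind n → Subset n
added {n} ab = twoToN n
added (cd S) = S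

high : Face n → Kind n → Face (suc n)
high F k = low F k ∪｛ ext (added k) ｝

above : Face n → Kind n → Face n
above F ab     T = ⊥
above F (cd S) T = F T × S ⊆ T

record Pair (n : ℕ) : Set₁ where
  constructor pair
  field
    face   : Face n
    isFace : IsFace n face
    kind   : Kind n
    valid  : Valid face kind

open Pair

lower upper : Pair n → Face (suc n)
lower P = low (face P) (kind P)
upper P = high (face P) (kind P)

data OnPair (P : Pair n) (X : Face (suc n)) : Set where
  isLower : X ≈ lower P → OnPair P X
  isUpper : X ≈ upper P → OnPair P X

fromInQ : {X : Face (suc n)} → InQ n X → Σ (Pair n) λ P → OnPair P X
fromInQ (inj₁ (F , isF , e))                        = pair F isF ab tt , isLower e
fromInQ (inj₂ (inj₁ (F , isF , e)))                 = pair F isF ab tt , isUpper e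
fromInQ (inj₂ (inj₂ (inj₁ (F , isF , S , s , e)))) = pair F isF (cd S) s , isLower e
fromInQ (inj₂ (inj₂ (inj₂ (F , isF , S , s , e)))) = pair F isF (cd S) s , isUpper e

toInQ : {X : Face (suc n)} (P : Pair n) → OnPair P X → InQ n X
toInQ (pair F isF ab     _) (isLower e) = inj₁ (F , isF , e)
toInQ (pair F isF ab     _) (isUpper e) = inj₂ (inj₁ (F , isF , e))
toInQ (pair F isF (cd S) s) (isLower e) = inj₂ (inj₂ (inj₁ (F , isF , S , s , e)))
toInQ (pair F isF (cd S) s) (isUpper e) = inj₂ (inj₂ (inj₂ (F , isF , S , s , e)))

fromInM : {G H : Face (suc n)} → InM n G H → Σ (Pair n) λ P → G ≈ lower P × H ≈ upper P
fromInM (inj₁ (F , isF , eG , eH))         = pair F isF ab tt , eG , eH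
fromInM (inj₂ (F , isF , S , s , eG , eH)) = pair F isF (cd S) s , eG , eH

toInM : {G H : Face (suc n)} (P : Pair n) → G ≈ lower P → H ≈ upper P → InM n G H
toInM (pair F isF ab     _) eG eH = inj₁ (F , isF , eG , eH)
toInM (pair F isF (cd S) s) eG eH = inj₂ (F , isF , S , s , eG , eH)

low-ext : {F : Face n} (k : Kind n) {T : Subset n} → low F k (ext T) → F T × ¬ above F k T
low-ext ab {T} (T′ , eq , f) with ∷ʳ-injectiveˡ T T′ eq
... | refl = f , λ ()
low-ext (cd S) (inj₁ (_ , eq , _)) = ⊥-elim (ext≢addLast eq)
low-ext (cd S) {T} (inj₂ (T′ , eq , f , S⊈T)) with ∷ʳ-injectiveˡ T T′ eq
... | refl = f , S⊈T ∘ proj₂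

low-addLast : {F : Face n} (k : Kind n) {T : Subset n} → low F k (addLast T) → above F k T
low-addLast ab (_ , eq , _) = ext≢addLast (sym eq)
low-addLast (cd S) {T} (inj₁ (T′ , eq , f , S⊆T)) with ∷ʳ-injectiveˡ T T′ eq
... | refl = f , S⊆T
low-addLast (cd S) (inj₂ (_ , eq , _)) = ⊥-elim (ext≢addLast (sym eq))

above-addLast : {F : Face n} (k : Kind n) {T : Subset n} → above F k T → low F k (addLast T)
above-addLast (cd S) {T} (f , S⊆T) = inj₁ (T , refl , f , S⊆T)

above⊑face : {F : Face n} (k : Kind n) → above F k ⊑ F
above⊑face (cd S) T = proj₁

face⊑erase-low : {F : Face n} (k : Kind n) → IsFace n F → F ⊑ erase (low F k)
face⊑erase-low {F = F} k isF T f = proj₁ isF T f , placed k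
  where
  placed : ∀ k → low F k (ext T) ⊎ low F k (addLast T)
  placed ab = inj₁ (T , refl , f)
  placed (cd S) with S ⊆? T
  ... | yes S⊆T = inj₂ (inj₁ (T , refl , f , S⊆T))
  ... | no  S⊈T = inj₁ (inj₂ (T , refl , f , S⊈T))

erase-low⊑face : {F : Face n} (k : Kind n) → erase (low F k) ⊑ F
erase-low⊑face k T (_ , inj₁ x) = proj₁ (low-ext k x)
erase-low⊑face k T (_ , inj₂ x) = above⊑face k T (low-addLast k x)

added-∈ : {F : Face n} (k : Kind n) → Valid F k → IsVertex n (added k) → F (added k)
added-∈ ab     _ v = ⊥-elim (twoToN-not-vertex _ v)
added-∈ (cd S) s _ = s

erase-high⊑face : {F : Face n} (k : Kind n) → Valid F k → erase (high F k) ⊑ F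
erase-high⊑face k _ T (vT , inj₁ (inj₁ x)) = erase-low⊑face k T (vT , inj₁ x)
erase-high⊑face k _ T (vT , inj₂ (inj₁ x)) = erase-low⊑face k T (vT , inj₂ x)
erase-high⊑face k _ T (_  , inj₂ (inj₂ eq)) = ⊥-elim (ext≢addLast (sym eq))
erase-high⊑face k v T (vT , inj₁ (inj₂ eq)) with ∷ʳ-injectiveˡ T (added k) eq
... | refl = added-∈ k v vT

lower⊑upper : (P : Pair n) → lower P ⊑ upper P
lower⊑upper P U = inj₁

erase-lower : (P : Pair n) → erase (lower P) ≈ face P
erase-lower P = erase-low⊑face (kind P) , face⊑erase-low (kind P) (isFace P)

erase-upper : (P : Pair n) → erase (upper P) ≈ face P
erase-upper P = erase-high⊑face (kind P) (valid P)
              , ⊑-trans (proj₂ (erase-lower P)) (erase-mono (lower⊑upper P))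

withLast-lower : (P : Pair n) → withLast (lower P) ≈ above (face P) (kind P)
withLast-lower P = (λ T → low-addLast (kind P)) , (λ T → above-addLast (kind P))

withLast-upper : (P : Pair n) → withLast (upper P) ≈ above (face P) (kind P)
withLast-upper P = (λ { T (inj₁ x) → low-addLast (kind P) x ; T (inj₂ eq) → ⊥-elim (ext≢addLast (sym eq)) })
                 , (λ T → inj₁ ∘ above-addLast (kind P))

onPair-erase : {P : Pair n} {X : Face (suc n)} → OnPair P X → erase X ≈ face P
onPair-erase {P = P} (isLower X≈) = ≈-trans (erase-cong X≈) (erase-lower P)
onPair-erase {P = P} (isUpper X≈) = ≈-trans (erase-cong X≈) (erase-upper P)

onPair-withLast : {P : Pair n} {X : Face (suc n)} → OnPair P X → withLast X ≈ above (face P) (kind P)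
onPair-withLast {P = P} (isLower X≈) = ≈-trans (withLast-cong X≈) (withLast-lower P)
onPair-withLast {P = P} (isUpper X≈) = ≈-trans (withLast-cong X≈) (withLast-upper P)

infix 4 _≼_ _∼_

record _≼_ (X Y : Face (suc n)) : Set where
  constructor mk≼
  field
    erase-⊑    : erase X ⊑ erase Y
    withLast-⊑ : withLast X ⊑ withLast Y

record _∼_ (X Y : Face (suc n)) : Set where
  constructor mk∼
  field
    erase-≈    : erase X ≈ erase Y
    withLast-≈ : withLast X ≈ withLast Y

≼-trans : {X Y Z : Face (suc n)} → X ≼ Y → Y ≼ Z → X ≼ Z
≼-trans (mk≼ e w) (mk≼ e′ w′) = mk≼ (⊑-trans e e′) (⊑-trans w w′)

⊑⇒≼ : {X Y : Face (suc n)} → X ⊑ Y → X ≼ Y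
⊑⇒≼ X⊑Y = mk≼ (erase-mono X⊑Y) (withLast-mono X⊑Y)

≈⇒∼ : {X Y : Face (suc n)} → X ≈ Y → X ∼ Y
≈⇒∼ X≈Y = mk∼ (erase-cong X≈Y) (withLast-cong X≈Y)

≼-antisym : {X Y : Face (suc n)} → X ≼ Y → Y ≼ X → X ∼ Y
≼-antisym (mk≼ e w) (mk≼ e′ w′) = mk∼ (e , e′) (w , w′)

∼⇒≽ : {X Y : Face (suc n)} → X ∼ Y → Y ≼ X
∼⇒≽ (mk∼ (_ , e) (_ , w)) = mk≼ e w

∼-sym : {X Y : Face (suc n)} → X ∼ Y → Y ∼ X
∼-sym (mk∼ e w) = mk∼ (≈-sym e) (≈-sym w)

∼-trans : {X Y Z : Face (suc n)} → X ∼ Y → Y ∼ Z → X ∼ Z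
∼-trans (mk∼ e w) (mk∼ e′ w′) = mk∼ (≈-trans e e′) (≈-trans w w′)

same-pair⇒∼ : {P : Pair n} {X Y : Face (suc n)} → OnPair P X → OnPair P Y → X ∼ Y
same-pair⇒∼ oX oY = mk∼ (≈-trans (onPair-erase oX) (≈-sym (onPair-erase oY)))
                        (≈-trans (onPair-withLast oX) (≈-sym (onPair-withLast oY)))

kind-injective : {F F′ : Face n} (k k′ : Kind n) → Valid F k → Valid F′ k′ →
                 above F k ≈ above F′ k′ → k ≡ k′
kind-injective ab     ab      _ _  _       = refl
kind-injective ab     (cd S′) _ s′ (_ , ⊒) = ⊥-elim (⊒ S′ (s′ , ⊆-refl))
kind-injective (cd S) ab      s _  (⊑ , _) = ⊥-elim (⊑ S (s , ⊆-refl))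
kind-injective (cd S) (cd S′) s s′ (⊑ , ⊒) =
  cong cd (⊆-antisym (proj₂ (⊒ S′ (s′ , ⊆-refl))) (proj₂ (⊑ S (s , ⊆-refl))))

low-mono : {F F′ : Face n} (k : Kind n) → F ⊑ F′ → low F k ⊑ low F′ k
low-mono ab     F⊑F′ U (T , eq , f)               = T , eq , F⊑F′ T f
low-mono (cd S) F⊑F′ U (inj₁ (T , eq , f , S⊆T)) = inj₁ (T , eq , F⊑F′ T f , S⊆T)
low-mono (cd S) F⊑F′ U (inj₂ (T , eq , f , S⊈T)) = inj₂ (T , eq , F⊑F′ T f , S⊈T)

pair-cong : (P P′ : Pair n) → face P ≈ face P′ → kind P ≡ kind P′ →
            lower P ≈ lower P′ × upper P ≈ upper P′
pair-cong (pair F _ k _) (pair F′ _ .k _) (F⊑F′ , F′⊑F) refl =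
    (low-mono k F⊑F′ , low-mono k F′⊑F)
  , ((λ U → map₁ (low-mono k F⊑F′ U)) , (λ U → map₁ (low-mono k F′⊑F U)))

∼⇒same-pair : {P P′ : Pair n} {X Y : Face (suc n)} → OnPair P X → OnPair P′ Y → X ∼ Y →
              lower P ≈ lower P′ × upper P ≈ upper P′
∼⇒same-pair {P = P} {P′} oX oY (mk∼ e w) =
  pair-cong P P′ face≈ (kind-injective (kind P) (kind P′) (valid P) (valid P′) above≈)
  where
  face≈ = ≈-trans (≈-sym (onPair-erase oX)) (≈-trans e (onPair-erase oY))
  above≈ = ≈-trans (≈-sym (onPair-withLast oX)) (≈-trans w (onPair-withLast oY))

added∉lower : (P : Pair n) → ¬ lower P (ext (added (kind P)))
added∉lower (pair F isF ab     _) x = twoToN-not-vertex _ (proj₁ isF _ (proj₁ (low-ext ab x)))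
added∉lower (pair F isF (cd S) s) x = proj₂ (low-ext (cd S) x) (s , ⊆-refl)

matched-covers : ∀ G H → InM n G H → CoverQ n G H
matched-covers _ _ m with fromInM m
... | P , G≈ , H≈ with adjoin-covers (added∉lower P) G≈ H≈
...   | G⊏H , nothing-between =
  toInQ P (isLower G≈) , toInQ P (isUpper H≈) , G⊏H , λ (_ , _ , G⊏K , K⊏H) → nothing-between G⊏K K⊏H

matched-∼ : {G H : Face (suc n)} → InM n G H → G ∼ H
matched-∼ m with fromInM m
... | P , G≈ , H≈ = same-pair⇒∼ {P = P} (isLower G≈) (isUpper H≈)

overlap⇒∼ : {G H G′ H′ : Face (suc n)} → G ∼ H → G′ ∼ H′ →
            (G ≈ G′) ⊎ (G ≈ H′) ⊎ (H ≈ G′) ⊎ (H ≈ H′) → G ∼ G′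
overlap⇒∼ G∼H G′∼H′ (inj₁ G≈G′)               = ≈⇒∼ G≈G′
overlap⇒∼ G∼H G′∼H′ (inj₂ (inj₁ G≈H′))        = ∼-trans (≈⇒∼ G≈H′) (∼-sym G′∼H′)
overlap⇒∼ G∼H G′∼H′ (inj₂ (inj₂ (inj₁ H≈G′))) = ∼-trans G∼H (≈⇒∼ H≈G′)
overlap⇒∼ G∼H G′∼H′ (inj₂ (inj₂ (inj₂ H≈H′))) = ∼-trans G∼H (∼-trans (≈⇒∼ H≈H′) (∼-sym G′∼H′))

matched-disjoint : ∀ G H G′ H′ → InM n G H → InM n G′ H′ →
                   (G ≈ G′) ⊎ (G ≈ H′) ⊎ (H ≈ G′) ⊎ (H ≈ H′) → (G ≈ G′) × (H ≈ H′)
matched-disjoint G H G′ H′ m m′ shared with fromInM m | fromInM m′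
... | P , G≈ , H≈ | P′ , G′≈ , H′≈
  with ∼⇒same-pair {P = P} {P′} (isLower G≈) (isLower G′≈) (overlap⇒∼ (matched-∼ m) (matched-∼ m′) shared)
... | lower≈ , upper≈ = ≈-trans G≈ (≈-trans lower≈ (≈-sym G′≈)) , ≈-trans H≈ (≈-trans upper≈ (≈-sym H′≈))

⊏∧≽⇒matched : {X Y : Face (suc n)} → InQ n X → InQ n Y → Y ⊏ X → X ≼ Y → InM n Y X
⊏∧≽⇒matched qX qY (Y⊑X , X⋢Y) X≼Y with fromInQ qX | fromInQ qY
... | P , oX | P′ , oY with ∼⇒same-pair oX oY (≼-antisym X≼Y (⊑⇒≼ Y⊑X)) | oX | oY
... | (l⊑l′ , _) , _ | isLower (X⊑ , _) | isLower (_ , ⊑Y) = ⊥-elim (X⋢Y (⊑-trans X⊑ (⊑-trans l⊑l′ ⊑Y)))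
... | _ , (u⊑u′ , _) | isUpper (X⊑ , _) | isUpper (_ , ⊑Y) = ⊥-elim (X⋢Y (⊑-trans X⊑ (⊑-trans u⊑u′ ⊑Y)))
... | _ , (u⊑u′ , _) | isLower (X⊑ , _) | isUpper (_ , ⊑Y) =
  ⊥-elim (X⋢Y (⊑-trans X⊑ (⊑-trans (lower⊑upper P) (⊑-trans u⊑u′ ⊑Y))))
... | _ , u≈u′       | isUpper X≈       | isLower Y≈       = toInM P′ Y≈ (≈-trans X≈ u≈u′)

open module MorseOrder {n} = Lexicographic (_≼_ {n}) (λ {X Y Z} → ≼-trans {X = X} {Y} {Z})
                                          _⊏_ (λ {F G H} → ⊏-trans {F = F} {G} {H})
  renaming (_⊲_ to _≺_; ⊲-trans to ≺-trans; ⊲-irrefl to ≺-irrefl)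

morseEdge⇒≺ : {X Y : Face (suc n)} → MorseEdge n (InM n) X Y → X ≺ Y
morseEdge⇒≺ (inj₂ ((_ , _ , X⊏Y , _) , m)) = ∼⇒≽ (matched-∼ m) , λ _ → X⊏Y
morseEdge⇒≺ (inj₁ ((qY , qX , Y⊏X , _) , ¬m)) =
  ⊑⇒≼ (proj₁ Y⊏X) , λ X≼Y → ⊥-elim (¬m (⊏∧≽⇒matched qX qY Y⊏X X≼Y))

acyclic : AcyclicQ n (InM n)
acyclic G cycle = ≺-irrefl ⊏-irrefl (transClosure-minimal morseEdge⇒≺ ≺-trans cycle)

isMorseMatching : IsMorseMatchingQ n (InM n)
isMorseMatching = (matched-covers , matched-disjoint) , acyclic

proposition4p5 : (n : ℕ) → 3 ≤ n → IsMorseMatchingQ n (InM n)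
proposition4p5 n _ = isMorseMatching
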